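{- Let $\mathcal{M}=(E,\mathcal{I})$ be a matroid and $B_1,B_2$ two disjoint bases. Let $X\subseteq B_2$ and $Y\subseteq B_1$ with $|Y|\le |X|$, and let $e\in Y$. Suppose that for each $x\in X$ there is a circuit $C_x\subseteq B_1\cup B_2$ of $\mathcal{M}$ such that $C_x\cap X=\{x\}$ and $C_x\cap B_1\subseteq Y$. Then there exists a circuit $C$ of $\mathcal{M}$ such that $C\cap B_1=\{e\}$ and $C\subseteq\bigcup_{x\in X}C_x$.
   Context: A circuit is a minimal dependent set of the matroid. -}

module Defs where

open import Data.Nat using (ℕ; _<_)
open import Data.Fin using (Fin)
open import Data.Fin.Subset using (Subset; _∈_; _∉_; _⊆_; _⊂_; _∪_; ⁅_⁆; ⊥; ∣_∣)
open import Data.Product using (Σ; _×_; ∃-syntax)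
open import Relation.Nullary using (¬_; Dec)
open import Level using (suc; zero)

record Matroid (n : ℕ) : Set₁ where
  field
    Indep     : Subset n → Set
    -- finite matroid: independence is decidable (classically automatic)
    indep?    : ∀ A → Dec (Indep A)
    indep-∅   : Indep ⊥
    indep-⊆   : ∀ {A B} → A ⊆ B → Indep B → Indep A
    indep-aug : ∀ {A B} → Indep A → Indep B → ∣ A ∣ < ∣ B ∣ →
                ∃[ x ] (x ∈ B × x ∉ A × Indep (⁅ x ⁆ ∪ A))

  IsBasis : Subset n → Set
  IsBasis B = Indep B × (∀ A → Indep A → B ⊆ A → A ⊆ B)

  Dependent : Subset n → Set
  Dependent A = ¬ Indep A

  IsCircuit : Subset n → Set
  IsCircuit C = Dependent C × (∀ D → D ⊂ C → ¬ Dependent D)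

open Matroid public

_⊆⋃[_]_ : ∀ {n} → Subset n → Subset n → (Fin n → Subset n) → Set
C ⊆⋃[ X ] Cs = ∀ {y} → y ∈ C → ∃[ x ] (x ∈ X × y ∈ Cs x)

{-# OPTIONS --safe #-}
-- Put U = ⋃_{x ∈ X} C_x, S = U ∩ B₂ and A = (Y ∩ U) ∪ (S ∖ X). Every x ∈ X is spanned by
-- C_x − x ⊆ A, so the independent set S lies in the closure of A and |S| ≤ |A|, while
-- |A| ≤ |Y ∩ U| + |S| − |X| ≤ |S| − (|Y| − |Y ∩ U|). Hence Y ⊆ U, so e ∈ A, and S ∪ {e} also
-- lies in the closure of A while being larger than A: it is dependent. Its fundamental circuit
-- through e lies in U and meets B₁ only in e.
module Submission where

open import Defs
open import Data.Nat using (ℕ; _≤_)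
open import Data.Fin using (Fin)
open import Data.Fin.Subset using (Subset; _∈_; _⊆_; _∩_; _∪_; ⁅_⁆; ⊥; ∣_∣)
open import Data.Product using (_×_; ∃-syntax)
open import Relation.Binary.PropositionalEquality using (_≡_)

open import Data.Nat using (_+_; _<_; z≤n; s≤s; _≤?_)
open import Data.Nat.Properties
  using (≤-trans; ≤-reflexive; +-suc; +-monoˡ-≤; +-monoʳ-≤; n≤1+n; +-cancelˡ-≤; +-mono-<-≤;
         <-≤-trans; <⇒≱; ≰⇒>; +-commutativeSemigroup; module ≤-Reasoning)
open import Algebra.Properties.CommutativeSemigroup +-commutativeSemigroup using (x∙yz≈y∙xz)
open import Data.Fin.Properties using (any?; _≟_)
open import Data.Fin.Subset using (_∉_; _⊂_; _⊃_; _─_; _-_; outside; inside; Lift)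
open import Data.Fin.Subset.Properties
open import Data.Fin.Subset.Induction using (⊂-wellFounded; ⊃-wellFounded; Acc; acc)
open import Data.Product using (_,_; proj₁; proj₂)
open import Data.Sum as Sum using (_⊎_; inj₁; inj₂)
open import Data.Vec using ([]; _∷_; tabulate; here; there)
open import Data.Vec.Properties using ([]=⇒lookup; lookup⇒[]=; lookup∘tabulate)
open import Function using (_∘_; id; flip)
open import Relation.Binary.PropositionalEquality using (refl; sym; trans; subst)
open import Relation.Nullary using (¬_; yes; no; ¬?; contradiction)
open import Relation.Nullary.Decidable using (does; _×-dec_; dec-true; decidable-stable)
open import Relation.Unary using (Pred; Decidable)

private
  variable
    n : ℕ

subsetOf : ∀ {ℓ} {P : Pred (Fin n) ℓ} → Decidable P → Subset n
subsetOf P? = tabulate (does ∘ P?)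

module _ {ℓ} {P : Pred (Fin n) ℓ} (P? : Decidable P) {x : Fin n} where

  ∈-subsetOf⁺ : P x → x ∈ subsetOf P?
  ∈-subsetOf⁺ px = lookup⇒[]= x _ (trans (lookup∘tabulate _ x) (dec-true (P? x) px))

  ∈-subsetOf⁻ : x ∈ subsetOf P? → P x
  ∈-subsetOf⁻ x∈ with P? x | trans (sym (lookup∘tabulate (does ∘ P?) x)) ([]=⇒lookup x∈)
  ... | yes px | _ = px
  ... | no _   | ()

covered? : ∀ X (Cs : Fin n → Subset n) → Decidable (λ y → ∃[ x ] (x ∈ X × y ∈ Cs x))
covered? X Cs y = any? (λ x → (x ∈? X) ×-dec (y ∈? Cs x))

infix 25 ⋃[_]_
⋃[_]_ : Subset n → (Fin n → Subset n) → Subset n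
⋃[ X ] Cs = subsetOf (covered? X Cs)

∈⋃⁺ : ∀ {X : Subset n} {Cs x y} → x ∈ X → y ∈ Cs x → y ∈ ⋃[ X ] Cs
∈⋃⁺ {X = X} {Cs} {x} x∈X y∈Cx = ∈-subsetOf⁺ (covered? X Cs) (x , x∈X , y∈Cx)

∈⋃⁻ : ∀ {X : Subset n} {Cs} → ⋃[ X ] Cs ⊆⋃[ X ] Cs
∈⋃⁻ {X = X} {Cs} = ∈-subsetOf⁻ (covered? X Cs)

∣p∪q∣≤∣p∣+∣q∣ : ∀ (p q : Subset n) → ∣ p ∪ q ∣ ≤ ∣ p ∣ + ∣ q ∣
∣p∪q∣≤∣p∣+∣q∣ [] [] = z≤n
∣p∪q∣≤∣p∣+∣q∣ (outside ∷ p) (outside ∷ q) = ∣p∪q∣≤∣p∣+∣q∣ p q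
∣p∪q∣≤∣p∣+∣q∣ (inside ∷ p) (outside ∷ q) = s≤s (∣p∪q∣≤∣p∣+∣q∣ p q)
∣p∪q∣≤∣p∣+∣q∣ (outside ∷ p) (inside ∷ q) =
  ≤-trans (s≤s (∣p∪q∣≤∣p∣+∣q∣ p q)) (≤-reflexive (sym (+-suc ∣ p ∣ ∣ q ∣)))
∣p∪q∣≤∣p∣+∣q∣ (inside ∷ p) (inside ∷ q) =
  s≤s (≤-trans (∣p∪q∣≤∣p∣+∣q∣ p q) (+-monoʳ-≤ ∣ p ∣ (n≤1+n ∣ q ∣)))

∣q∣+∣p─q∣≤∣p∣ : ∀ (p q : Subset n) → q ⊆ p → ∣ q ∣ + ∣ p ─ q ∣ ≤ ∣ p ∣
∣q∣+∣p─q∣≤∣p∣ [] [] _ = z≤n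
∣q∣+∣p─q∣≤∣p∣ (outside ∷ p) (outside ∷ q) q⊆p = ∣q∣+∣p─q∣≤∣p∣ p q (drop-∷-⊆ q⊆p)
∣q∣+∣p─q∣≤∣p∣ (inside ∷ p) (outside ∷ q) q⊆p =
  ≤-trans (≤-reflexive (+-suc ∣ q ∣ ∣ p ─ q ∣)) (s≤s (∣q∣+∣p─q∣≤∣p∣ p q (drop-∷-⊆ q⊆p)))
∣q∣+∣p─q∣≤∣p∣ (outside ∷ p) (inside ∷ q) q⊆p = contradiction (q⊆p here) λ ()
∣q∣+∣p─q∣≤∣p∣ (inside ∷ p) (inside ∷ q) q⊆p = s≤s (∣q∣+∣p─q∣≤∣p∣ p q (drop-∷-⊆ q⊆p))

∣p∪[q─r]∣+∣r∣≤∣p∣+∣q∣ : ∀ (p q r : Subset n) → r ⊆ q → ∣ r ∣ + ∣ p ∪ (q ─ r) ∣ ≤ ∣ p ∣ + ∣ q ∣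
∣p∪[q─r]∣+∣r∣≤∣p∣+∣q∣ p q r r⊆q = begin
  ∣ r ∣ + ∣ p ∪ (q ─ r) ∣     ≤⟨ +-monoʳ-≤ ∣ r ∣ (∣p∪q∣≤∣p∣+∣q∣ p (q ─ r)) ⟩
  ∣ r ∣ + (∣ p ∣ + ∣ q ─ r ∣) ≡⟨ x∙yz≈y∙xz ∣ r ∣ ∣ p ∣ (∣ q ─ r ∣) ⟩
  ∣ p ∣ + (∣ r ∣ + ∣ q ─ r ∣) ≤⟨ +-monoʳ-≤ ∣ p ∣ (∣q∣+∣p─q∣≤∣p∣ q r r⊆q) ⟩
  ∣ p ∣ + ∣ q ∣               ∎
  where open ≤-Reasoning

x∈p─q⇒x∉q : ∀ {x : Fin n} (p q : Subset n) → x ∈ p ─ q → x ∉ q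
x∈p─q⇒x∉q (_ ∷ p) (outside ∷ q) here ()
x∈p─q⇒x∉q (_ ∷ p) (inside ∷ q) () here
x∈p─q⇒x∉q (_ ∷ p) (_ ∷ q) (there x∈p─q) (there x∈q) = x∈p─q⇒x∉q p q x∈p─q x∈q

p∩q≡⊥∧x∈p⇒x∉q : ∀ {x : Fin n} {p q} → p ∩ q ≡ ⊥ → x ∈ p → x ∉ q
p∩q≡⊥∧x∈p⇒x∉q p∩q≡⊥ x∈p x∈q = ∉⊥ (subst (_ ∈_) p∩q≡⊥ (x∈p∩q⁺ (x∈p , x∈q)))

p⊆q∪r∧p∩q⊆s⇒p⊆s∪r : ∀ {p q r s : Subset n} → p ⊆ q ∪ r → p ∩ q ⊆ s → p ⊆ s ∪ r
p⊆q∪r∧p∩q⊆s⇒p⊆s∪r {q = q} {r} p⊆q∪r p∩q⊆s x∈p =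
  x∈p∪q⁺ (Sum.map₁ (λ x∈q → p∩q⊆s (x∈p∩q⁺ (x∈p , x∈q))) (x∈p∪q⁻ q r (p⊆q∪r x∈p)))

x∈⁅y⁆∪p⁻ : ∀ {x y : Fin n} p → x ∈ ⁅ y ⁆ ∪ p → x ≡ y ⊎ x ∈ p
x∈⁅y⁆∪p⁻ {y = y} p x∈ = Sum.map₁ (x∈⁅y⁆⇒x≡y y) (x∈p∪q⁻ ⁅ y ⁆ p x∈)

x∈⁅x⁆∪p : ∀ {x : Fin n} p → x ∈ ⁅ x ⁆ ∪ p
x∈⁅x⁆∪p {x = x} p = x∈p∪q⁺ (inj₁ (x∈⁅x⁆ x))

⁅x⁆∪p⊆q : ∀ {x : Fin n} {p q} → x ∈ q → p ⊆ q → ⁅ x ⁆ ∪ p ⊆ q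
⁅x⁆∪p⊆q {p = p} x∈q p⊆q y∈ = Sum.[ (λ { refl → x∈q }) , p⊆q ]′ (x∈⁅y⁆∪p⁻ p y∈)

x∉p⇒p⊂⁅x⁆∪p : ∀ {x : Fin n} {p} → x ∉ p → p ⊂ ⁅ x ⁆ ∪ p
x∉p⇒p⊂⁅x⁆∪p {x = x} {p} x∉p = q⊆p∪q ⁅ x ⁆ p , x , x∈⁅x⁆∪p p , x∉p

p⊆⁅x⁆∪q⇒p∩r≡⁅x⁆ : ∀ {x : Fin n} {p q r} → p ⊆ ⁅ x ⁆ ∪ q → x ∈ p → x ∈ r → r ∩ q ≡ ⊥ →
                   p ∩ r ≡ ⁅ x ⁆
p⊆⁅x⁆∪q⇒p∩r≡⁅x⁆ {x = x} {p} {q} {r} p⊆⁅x⁆∪q x∈p x∈r r∩q≡⊥ = ⊆-antisym p∩r⊆⁅x⁆ ⁅x⁆⊆p∩r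
  where
  p∩r⊆⁅x⁆ : p ∩ r ⊆ ⁅ x ⁆
  p∩r⊆⁅x⁆ y∈p∩r =
    let y∈p , y∈r = x∈p∩q⁻ p r y∈p∩r
    in Sum.[ (λ { refl → x∈⁅x⁆ x }) , contradiction y∈r ∘ flip (p∩q≡⊥∧x∈p⇒x∉q r∩q≡⊥) ]′
             (x∈⁅y⁆∪p⁻ q (p⊆⁅x⁆∪q y∈p))

  ⁅x⁆⊆p∩r : ⁅ x ⁆ ⊆ p ∩ r
  ⁅x⁆⊆p∩r y∈⁅x⁆ with x∈⁅y⁆⇒x≡y x y∈⁅x⁆
  ... | refl = x∈p∩q⁺ (x∈p , x∈r)

module _ {ℓ} {P : Pred (Subset n) ℓ} (P? : Decidable P) where

  ⊂-minimal : ∀ {D} → P D → ∃[ C ] (C ⊆ D × P C × (∀ C′ → C′ ⊂ C → ¬ P C′))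
  ⊂-minimal {D} = go (⊂-wellFounded D)
    where
    go : ∀ {D} → Acc _⊂_ D → P D → ∃[ C ] (C ⊆ D × P C × (∀ C′ → C′ ⊂ C → ¬ P C′))
    go {D} (acc smaller) PD with anySubset? (λ C′ → (C′ ⊂? D) ×-dec P? C′)
    ... | yes (C′ , C′⊂D , PC′) =
      let C , C⊆C′ , PC , minimal = go (smaller C′⊂D) PC′
      in C , ⊆-trans C⊆C′ (p⊂q⇒p⊆q C′⊂D) , PC , minimal
    ... | no ∄C′ = D , ⊆-refl , PD , λ C′ C′⊂D PC′ → ∄C′ (C′ , C′⊂D , PC′)

  ⊃-maximal : ∀ {J} → P J → ∃[ K ] (J ⊆ K × P K × (∀ K′ → K ⊂ K′ → ¬ P K′))
  ⊃-maximal {J} = go (⊃-wellFounded J)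
    where
    go : ∀ {J} → Acc _⊃_ J → P J → ∃[ K ] (J ⊆ K × P K × (∀ K′ → K ⊂ K′ → ¬ P K′))
    go {J} (acc larger) PJ with anySubset? (λ K′ → (J ⊂? K′) ×-dec P? K′)
    ... | yes (K′ , J⊂K′ , PK′) =
      let K , K′⊆K , PK , maximal = go (larger J⊂K′) PK′
      in K , ⊆-trans (p⊂q⇒p⊆q J⊂K′) K′⊆K , PK , maximal
    ... | no ∄K′ = J , ⊆-refl , PJ , λ K′ J⊂K′ PK′ → ∄K′ (K′ , J⊂K′ , PK′)

module _ (M : Matroid n) where

  IsBasisOf : Subset n → Subset n → Set
  IsBasisOf J A = J ⊆ A × Indep M J × (∀ {x} → x ∈ A → x ∉ J → Dependent M (⁅ x ⁆ ∪ J))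

  Spans : Subset n → Fin n → Set
  Spans A x = x ∈ A ⊎ ∃[ D ] (D ⊆ A × Indep M D × Dependent M (⁅ x ⁆ ∪ D))

  dependent⇒⊇circuit : ∀ {D} → Dependent M D → ∃[ C ] (C ⊆ D × IsCircuit M C)
  dependent⇒⊇circuit depD =
    let C , C⊆D , depC , minimal = ⊂-minimal (¬? ∘ indep? M) depD
    in C , C⊆D , depC , minimal

  circuit⇒spans : ∀ {C A x} → IsCircuit M C → x ∈ C → C - x ⊆ A → Spans A x
  circuit⇒spans {C} {A} {x} (depC , minimal) x∈C C-x⊆A =
    inj₂ (C - x , C-x⊆A , indC-x , depC ∘ indep-⊆ M C⊆⁅x⁆∪C-x)
    where
    indC-x : Indep M (C - x)
    indC-x = decidable-stable (indep? M (C - x)) (minimal (C - x) (x∈p⇒p-x⊂p x∈C))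

    C⊆⁅x⁆∪C-x : C ⊆ ⁅ x ⁆ ∪ (C - x)
    C⊆⁅x⁆∪C-x {y} y∈C with y ≟ x
    ... | yes refl = x∈⁅x⁆∪p (C - x)
    ... | no y≢x = x∈p∪q⁺ (inj₂ (x∈p∧x≢y⇒x∈p-y y∈C y≢x))

  extend-to-basis : ∀ {L A} → L ⊆ A → Indep M L → ∃[ J ] (L ⊆ J × IsBasisOf J A)
  extend-to-basis {A = A} L⊆A indL =
    let J , L⊆J , (J⊆A , indJ) , maximal = ⊃-maximal (λ J → (J ⊆? A) ×-dec indep? M J) (L⊆A , indL)
    in J , L⊆J , J⊆A , indJ ,
       λ x∈A x∉J indJx → maximal _ (x∉p⇒p⊂⁅x⁆∪p x∉J) (⁅x⁆∪p⊆q x∈A J⊆A , indJx)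

  basis-maximum : ∀ {J A K} → IsBasisOf J A → K ⊆ A → Indep M K → ∣ K ∣ ≤ ∣ J ∣
  basis-maximum {J} {K = K} (_ , indJ , maximal) K⊆A indK with ∣ K ∣ ≤? ∣ J ∣
  ... | yes K≤J = K≤J
  ... | no K≰J =
    let x , x∈K , x∉J , indJx = indep-aug M indJ indK (≰⇒> K≰J)
    in contradiction indJx (maximal (K⊆A x∈K) x∉J)

  basis-spans : ∀ {J A x} → IsBasisOf J A → Spans A x → x ∉ J → Dependent M (⁅ x ⁆ ∪ J)
  basis-spans (_ , _ , maximal) (inj₁ x∈A) x∉J = maximal x∈A x∉J
  -- Extend D to a basis D′ of {x} ∪ A: it cannot contain x, as D ∪ {x} is dependent, so it is
  -- an independent subset of A, yet it is at least as large as the independent set J ∪ {x}.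
  basis-spans {J} {A} {x} J-basis@(J⊆A , _ , _) (inj₂ (D , D⊆A , indD , depDx)) x∉J indJx
    with extend-to-basis {A = ⁅ x ⁆ ∪ A} (⊆-trans D⊆A (q⊆p∪q ⁅ x ⁆ A)) indD
  ... | D′ , D⊆D′ , D′-basis@(D′⊆⁅x⁆∪A , indD′ , _) with x ∈? D′
  ...   | yes x∈D′ = depDx (indep-⊆ M (⁅x⁆∪p⊆q x∈D′ D⊆D′) indD′)
  ...   | no x∉D′ = <⇒≱ (<-≤-trans ∣J∣<∣⁅x⁆∪J∣ ∣⁅x⁆∪J∣≤∣D′∣) ∣D′∣≤∣J∣
    where
    ∣J∣<∣⁅x⁆∪J∣ : ∣ J ∣ < ∣ ⁅ x ⁆ ∪ J ∣
    ∣J∣<∣⁅x⁆∪J∣ = p⊂q⇒∣p∣<∣q∣ (x∉p⇒p⊂⁅x⁆∪p x∉J)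

    ∣⁅x⁆∪J∣≤∣D′∣ : ∣ ⁅ x ⁆ ∪ J ∣ ≤ ∣ D′ ∣
    ∣⁅x⁆∪J∣≤∣D′∣ = basis-maximum D′-basis (⁅x⁆∪p⊆q (x∈⁅x⁆∪p A) (⊆-trans J⊆A (q⊆p∪q ⁅ x ⁆ A))) indJx

    D′⊆A : D′ ⊆ A
    D′⊆A y∈D′ = Sum.[ (λ { refl → contradiction y∈D′ x∉D′ }) , id ]′ (x∈⁅y⁆∪p⁻ A (D′⊆⁅x⁆∪A y∈D′))

    ∣D′∣≤∣J∣ : ∣ D′ ∣ ≤ ∣ J ∣
    ∣D′∣≤∣J∣ = basis-maximum J-basis D′⊆A indD′

  independent-spanned⇒∣I∣≤∣A∣ : ∀ {I A} → Indep M I → Lift (Spans A) I → ∣ I ∣ ≤ ∣ A ∣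
  independent-spanned⇒∣I∣≤∣A∣ {I} {A} indI I-spanned =
    let J , _ , J-basis@(J⊆A , indJ , _) = extend-to-basis ⊥⊆ (indep-∅ M)
        J-basis-of-A∪I : IsBasisOf J (A ∪ I)
        J-basis-of-A∪I = ⊆-trans J⊆A (p⊆p∪q I) , indJ ,
                         λ x∈A∪I → basis-spans J-basis (Sum.[ inj₁ , I-spanned ]′ (x∈p∪q⁻ A I x∈A∪I))
    in ≤-trans (basis-maximum J-basis-of-A∪I (q⊆p∪q A I) indI) (p⊆q⇒∣p∣≤∣q∣ J⊆A)

  fundamental-circuit : ∀ {S e} → Indep M S → Dependent M (⁅ e ⁆ ∪ S) →
                        ∃[ C ] (IsCircuit M C × e ∈ C × C ⊆ ⁅ e ⁆ ∪ S)
  fundamental-circuit {S} {e} indS depeS with dependent⇒⊇circuit depeS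
  ... | C , C⊆⁅e⁆∪S , C-circuit@(depC , _) with e ∈? C
  ...   | yes e∈C = C , C-circuit , e∈C , C⊆⁅e⁆∪S
  ...   | no e∉C = contradiction (indep-⊆ M C⊆S indS) depC
    where
    C⊆S : C ⊆ S
    C⊆S y∈C = Sum.[ (λ { refl → contradiction y∈C e∉C }) , id ]′ (x∈⁅y⁆∪p⁻ S (C⊆⁅e⁆∪S y∈C))

module _ (M : Matroid n) {B X Y : Subset n} (Cs : Fin n → Subset n)
         (indB : Indep M B) (X⊆B : X ⊆ B) (∣Y∣≤∣X∣ : ∣ Y ∣ ≤ ∣ X ∣)
         (Cx-circuit : ∀ {x} → x ∈ X → IsCircuit M (Cs x))
         (Cx⊆Y∪B : ∀ {x} → x ∈ X → Cs x ⊆ Y ∪ B)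
         (Cx∩X≡⁅x⁆ : ∀ {x} → x ∈ X → Cs x ∩ X ≡ ⁅ x ⁆)
         where

  private
    U S A : Subset n
    U = ⋃[ X ] Cs
    S = U ∩ B
    A = (Y ∩ U) ∪ (S ─ X)

    x∈Cx : ∀ {x} → x ∈ X → x ∈ Cs x
    x∈Cx {x} x∈X = proj₁ (x∈p∩q⁻ (Cs x) X (subst (x ∈_) (sym (Cx∩X≡⁅x⁆ x∈X)) (x∈⁅x⁆ x)))

    X⊆S : X ⊆ S
    X⊆S x∈X = x∈p∩q⁺ (∈⋃⁺ x∈X (x∈Cx x∈X) , X⊆B x∈X)

    indS : Indep M S
    indS = indep-⊆ M (p∩q⊆q U B) indB

    Cx-x⊆A : ∀ {x} → x ∈ X → Cs x - x ⊆ A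
    Cx-x⊆A {x} x∈X {y} y∈Cx-x = x∈p∪q⁺ (Sum.map in-Y∩U in-S─X (x∈p∪q⁻ Y B (Cx⊆Y∪B x∈X y∈Cx)))
      where
      y∈Cx : y ∈ Cs x
      y∈Cx = p─q⊆p (Cs x) ⁅ x ⁆ y∈Cx-x

      y∉X : y ∉ X
      y∉X y∈X = x∈p─q⇒x∉q (Cs x) ⁅ x ⁆ y∈Cx-x (subst (y ∈_) (Cx∩X≡⁅x⁆ x∈X) (x∈p∩q⁺ (y∈Cx , y∈X)))

      in-Y∩U : y ∈ Y → y ∈ Y ∩ U
      in-Y∩U y∈Y = x∈p∩q⁺ (y∈Y , ∈⋃⁺ x∈X y∈Cx)

      in-S─X : y ∈ B → y ∈ S ─ X
      in-S─X y∈B = x∈p∧x∉q⇒x∈p─q (x∈p∩q⁺ (∈⋃⁺ x∈X y∈Cx , y∈B)) y∉X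

    S-spanned : Lift (Spans M A) S
    S-spanned {x} x∈S with x ∈? X
    ... | yes x∈X = circuit⇒spans M (Cx-circuit x∈X) (x∈Cx x∈X) (Cx-x⊆A x∈X)
    ... | no x∉X = inj₁ (x∈p∪q⁺ (inj₂ (x∈p∧x∉q⇒x∈p─q x∈S x∉X)))

    counting : ∣ Y ∣ + ∣ A ∣ ≤ ∣ Y ∩ U ∣ + ∣ S ∣
    counting = ≤-trans (+-monoˡ-≤ ∣ A ∣ ∣Y∣≤∣X∣) (∣p∪[q─r]∣+∣r∣≤∣p∣+∣q∣ (Y ∩ U) S X X⊆S)

  Y⊆⋃ : Y ⊆ ⋃[ X ] Cs
  Y⊆⋃ {e} e∈Y with e ∈? U
  ... | yes e∈U = e∈U
  ... | no e∉U = contradiction counting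
                   (<⇒≱ (+-mono-<-≤ ∣Y∩U∣<∣Y∣ (independent-spanned⇒∣I∣≤∣A∣ M indS S-spanned)))
    where
    ∣Y∩U∣<∣Y∣ : ∣ Y ∩ U ∣ < ∣ Y ∣
    ∣Y∩U∣<∣Y∣ = p⊂q⇒∣p∣<∣q∣ (p∩q⊆p Y U , e , e∈Y , e∉U ∘ proj₂ ∘ x∈p∩q⁻ Y U)

  ⁅e⁆∪⋃∩B-dependent : ∀ {e} → e ∈ Y → e ∉ B → Dependent M (⁅ e ⁆ ∪ (⋃[ X ] Cs ∩ B))
  ⁅e⁆∪⋃∩B-dependent {e} e∈Y e∉B indI =
    <⇒≱ (<-≤-trans ∣S∣<∣I∣ (independent-spanned⇒∣I∣≤∣A∣ M indI I-spanned)) ∣A∣≤∣S∣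
    where
    I-spanned : Lift (Spans M A) (⁅ e ⁆ ∪ S)
    I-spanned y∈I = Sum.[ (λ { refl → inj₁ (x∈p∪q⁺ (inj₁ (x∈p∩q⁺ (e∈Y , Y⊆⋃ e∈Y))))}) , S-spanned ]′
                      (x∈⁅y⁆∪p⁻ S y∈I)

    ∣S∣<∣I∣ : ∣ S ∣ < ∣ ⁅ e ⁆ ∪ S ∣
    ∣S∣<∣I∣ = p⊂q⇒∣p∣<∣q∣ (x∉p⇒p⊂⁅x⁆∪p (e∉B ∘ proj₂ ∘ x∈p∩q⁻ U B))

    ∣A∣≤∣S∣ : ∣ A ∣ ≤ ∣ S ∣
    ∣A∣≤∣S∣ = +-cancelˡ-≤ ∣ Y ∣ _ _ (≤-trans counting (+-monoˡ-≤ ∣ S ∣ (∣p∩q∣≤∣p∣ Y U)))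

  circuit-through-⋃ : ∀ {e} → e ∈ Y → e ∉ B →
                      ∃[ C ] (IsCircuit M C × e ∈ C × C ⊆ ⁅ e ⁆ ∪ B × C ⊆ ⋃[ X ] Cs)
  circuit-through-⋃ {e} e∈Y e∉B =
    let C , C-circuit , e∈C , C⊆⁅e⁆∪S = fundamental-circuit M indS (⁅e⁆∪⋃∩B-dependent e∈Y e∉B)
    in C , C-circuit , e∈C , ⊆-trans C⊆⁅e⁆∪S (⁅x⁆∪p⊆q (x∈⁅x⁆∪p B) (q⊆p∪q ⁅ e ⁆ B ∘ p∩q⊆q U B)) ,
       ⊆-trans C⊆⁅e⁆∪S (⁅x⁆∪p⊆q (Y⊆⋃ e∈Y) (p∩q⊆p U B))

lemma3p4 : ∀ {n} (M : Matroid n) (B₁ B₂ X Y : Subset n) (e : Fin n) →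
           IsBasis M B₁ → IsBasis M B₂ → B₁ ∩ B₂ ≡ ⊥ →
           X ⊆ B₂ → Y ⊆ B₁ → ∣ Y ∣ ≤ ∣ X ∣ → e ∈ Y →
           (Cs : Fin n → Subset n) →
           (∀ x → x ∈ X → IsCircuit M (Cs x) × Cs x ⊆ B₁ ∪ B₂ ×
                          Cs x ∩ X ≡ ⁅ x ⁆ × Cs x ∩ B₁ ⊆ Y) →
           ∃[ C ] (IsCircuit M C × C ∩ B₁ ≡ ⁅ e ⁆ × C ⊆⋃[ X ] Cs)
lemma3p4 M B₁ B₂ X Y e _ (indB₂ , _) B₁∩B₂≡⊥ X⊆B₂ Y⊆B₁ ∣Y∣≤∣X∣ e∈Y Cs hyp =
  let C , C-circuit , e∈C , C⊆⁅e⁆∪B₂ , C⊆⋃ =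
        circuit-through-⋃ M Cs indB₂ X⊆B₂ ∣Y∣≤∣X∣ (proj₁ ∘ hyp _) Cx⊆Y∪B₂ (proj₁ ∘ proj₂ ∘ proj₂ ∘ hyp _)
          e∈Y (p∩q≡⊥∧x∈p⇒x∉q B₁∩B₂≡⊥ e∈B₁)
  in C , C-circuit , p⊆⁅x⁆∪q⇒p∩r≡⁅x⁆ C⊆⁅e⁆∪B₂ e∈C e∈B₁ B₁∩B₂≡⊥ , ∈⋃⁻ ∘ C⊆⋃
  where
  e∈B₁ : e ∈ B₁
  e∈B₁ = Y⊆B₁ e∈Y

  Cx⊆Y∪B₂ : ∀ {x} → x ∈ X → Cs x ⊆ Y ∪ B₂
  Cx⊆Y∪B₂ x∈X = let _ , Cx⊆B₁∪B₂ , _ , Cx∩B₁⊆Y = hyp _ x∈X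
                in p⊆q∪r∧p∩q⊆s⇒p⊆s∪r Cx⊆B₁∪B₂ Cx∩B₁⊆Y
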